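{- Let $n \ge 5$ and suppose $y\in\mathbb{Z}^{\binom{n}{2}}$ is a facet normal of $\tau_n$ in standard form. The following are equivalent: (a) $\langle y,\mathds{1}_K \rangle \equiv 0 \pmod{3}$ for all triangles $K$; (b) no entry of $y$ is $\equiv 0 \pmod{3}$; (c) all entries of $y$ are $\equiv 1 \pmod{3}$, or all entries of $y$ are $\equiv 2 \pmod{3}$.
   Context: Vectors in $\mathbb{R}^{\binom{n}{2}}$ are indexed by the $2$-subsets (edges) of $[n]$. For a $3$-subset $K$, $\mathds{1}_K$ denotes the vector equal to $1$ on the three $2$-subsets of $K$ and $0$ elsewhere (a triangle). $\tau_n$ is the cone generated by all triangles. A vector $y$ is a facet normal of $\tau_n$ if (1) $\langle y, \mathds{1}_K\rangle \ge 0$ for all triangles $K$, and (2) the linear span of the triangles $\mathds{1}_K$ with $\langle y, \mathds{1}_K\rangle=0$ has codimension $1$. A facet normal is in standard form if its entries are integers with greatest common divisor $1$. -}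

module Defs where

open import Data.Nat using (ℕ)
open import Data.Fin using (Fin; _<_)
open import Data.Fin.Properties using (_≟_; <-trans)
open import Data.Integer as ℤ using (ℤ; +_; _≥_)
open import Data.Integer.Divisibility as ℤD using ()
open import Data.Rational as ℚ using (ℚ; 0ℚ; 1ℚ)
open import Data.Product using (Σ; ∃; _×_; _,_)
open import Data.Sum using (_⊎_)
open import Data.List using (List; map; foldr)
open import Data.List.Relation.Unary.All using (All)
open import Relation.Nullary using (¬_; yes; no)
open import Relation.Nullary.Decidable using (_×-dec_; _⊎-dec_)
open import Relation.Binary.PropositionalEquality using (_≡_)

Edge : ℕ → Set
Edge n = Σ (Fin n × Fin n) λ { (i , j) → i < j }

Triangle : ℕ → Set
Triangle n = Σ (Fin n × Fin n × Fin n) λ { (i , j , k) → (i < j) × (j < k) }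

ℤVec : ℕ → Set
ℤVec n = Edge n → ℤ

ℚVec : ℕ → Set
ℚVec n = Edge n → ℚ

e₁ e₂ e₃ : ∀ {n} → Triangle n → Edge n
e₁ ((i , j , k) , i<j , j<k) = (i , j) , i<j
e₂ ((i , j , k) , i<j , j<k) = (i , k) , <-trans i<j j<k
e₃ ((i , j , k) , i<j , j<k) = (j , k) , j<k

𝟙 : ∀ {n} → Triangle n → ℚVec n
𝟙 ((i , j , k) , _) ((a , b) , _) with ((a ≟ i) ×-dec (b ≟ j)) ⊎-dec ((a ≟ i) ×-dec (b ≟ k)) ⊎-dec ((a ≟ j) ×-dec (b ≟ k))
... | yes _ = 1ℚ
... | no  _ = 0ℚ

⟨_,𝟙_⟩ : ∀ {n} → ℤVec n → Triangle n → ℤ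
⟨ y ,𝟙 K ⟩ = y (e₁ K) ℤ.+ y (e₂ K) ℤ.+ y (e₃ K)

Tight : ∀ {n} → ℤVec n → Triangle n → Set
Tight y K = ⟨ y ,𝟙 K ⟩ ≡ + 0

InTightSpan : ∀ {n} → ℤVec n → ℚVec n → Set
InTightSpan {n} y v =
  ∃ λ (L : List (Triangle n × ℚ)) →
    All (λ { (K , _) → Tight y K }) L ×
    (∀ e → v e ≡ foldr ℚ._+_ 0ℚ (map (λ { (K , c) → c ℚ.* 𝟙 K e }) L))

TightSpanCodim1 : ∀ {n} → ℤVec n → Set
TightSpanCodim1 {n} y =
  ∃ λ (w : ℚVec n) →
    ¬ InTightSpan y w ×
    (∀ (v : ℚVec n) → ∃ λ (c : ℚ) → InTightSpan y (λ e → v e ℚ.- c ℚ.* w e))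

FacetNormal : ∀ {n} → ℤVec n → Set
FacetNormal {n} y = (∀ (K : Triangle n) → ⟨ y ,𝟙 K ⟩ ≥ + 0) × TightSpanCodim1 y

-- Standard form: integer entries whose gcd is 1 (every common divisor is ±1).
StandardForm : ∀ {n} → ℤVec n → Set
StandardForm y = ∀ (d : ℤ) → (∀ e → d ℤD.∣ y e) → ℤ.∣ d ∣ ≡ 1

-- (a) ⇒ (c): on four vertices, the four triangle sums combine to twice the difference of two
-- opposite edges, so opposite edges are congruent mod 3; for n ≥ 5 the relation "disjoint"
-- connects all edges, so all entries share one residue, which is not 0 since y is primitive.
--
-- (b) ⇒ (c): a tight triangle has entry sum 0 and no entry divisible by 3, so its three entries
-- have the same residue. Splitting y into its part a₁ on one residue class and the rest a₂, both
-- a₁ and a₂ vanish on every tight triangle, i.e. pairing with them kills the span of the tight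
-- triangles. As that span has codimension 1, such functionals are proportional, which forces
-- a₁(e₀) a₂(e) = a₁(e) a₂(e₀) = 0 for edges e₀, e of different residues, contradicting (b).

module Submission where

open import Defs
open import Data.Nat using (ℕ; _≤_)
open import Data.Integer using (ℤ; +_; _-_)
open import Data.Integer.Divisibility using (_∣_)
open import Data.Product using (_×_)
open import Data.Sum using (_⊎_)
open import Function.Bundles using (_⇔_)
open import Relation.Nullary using (¬_)

open import Algebra.Bundles using (Monoid; Semiring; CommutativeRing)
open import Data.Bool using (Bool; true; false; not; if_then_else_)
open import Data.Empty using (⊥-elim)
open import Data.Fin using (Fin; zero; suc; _<_)
open import Data.Fin.Properties using (_<?_; _≟_; <-irrelevant; <-irrefl; <-trans; suc-injective)
import Data.Integer.Properties as ℤ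
open import Data.Integer.DivMod using (_%ℕ_; _/ℕ_; a≡a%ℕn+[a/ℕn]*n; n%ℕd<d)
import Data.Integer.Divisibility.Signed as Signed
open import Data.Integer.Tactic.RingSolver using (solve-∀)
open import Data.List using ([]; _∷_; map; foldr)
open import Data.List.Relation.Unary.All using (All; []; _∷_)
import Data.Nat as ℕ
open import Data.Nat using (zero; suc; z≤n; s≤s; z<s; s<s)
import Data.Nat.Divisibility as ℕ
open import Data.Product using (_,_; proj₁; proj₂)
open import Data.Rational as ℚ using (ℚ; 0ℚ; 1ℚ)
open import Data.Rational.Literals using (fromℤ)
import Data.Rational.Properties as ℚ
open import Data.Rational.Solver using (module +-*-Solver)
import Data.Rational.Unnormalised as ℚᵘ using (*≡*)
import Data.Rational.Unnormalised.Properties as ℚᵘ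
open import Data.Sum using (inj₁; inj₂; [_,_]′)
open import Data.Vec.Functional using (Vector; tail)
open import Function using (_∘_)
open import Level using (0ℓ)
open import Function.Bundles using (mk⇔)
open import Relation.Nullary using (Dec; yes; no; does)
open import Relation.Nullary.Decidable as Dec using (recompute; from-no; dec-true; does-⇔; _×-dec_)
open import Relation.Binary.PropositionalEquality
open ≡-Reasoning

module _ {c ℓ} (M : Monoid c ℓ) where

  open Monoid M using (Carrier; _≈_; ∙-congˡ; ∙-congʳ; identityˡ; identityʳ)
    renaming (ε to 0#; trans to ≈-trans)
  open import Algebra.Properties.Monoid.Sum M using (sum; sum-cong-≋; sum-replicate-zero)

  sum-zero : ∀ {n} (t : Vector Carrier n) → (∀ i → t i ≈ 0#) → sum t ≈ 0#
  sum-zero {n} t t≈0 = ≈-trans (sum-cong-≋ t≈0) (sum-replicate-zero n)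

  sum-single : ∀ {n} (t : Vector Carrier n) i → (∀ j → ¬ j ≡ i → t j ≈ 0#) → sum t ≈ t i
  sum-single t zero others =
    ≈-trans (∙-congˡ (sum-zero (tail t) λ j → others (suc j) λ ())) (identityʳ (t zero))
  sum-single t (suc i) others =
    ≈-trans (∙-congʳ (others zero λ ())) (≈-trans (identityˡ _)
      (sum-single (tail t) i λ j j≢i → others (suc j) (j≢i ∘ suc-injective)))

module _ {c ℓ} (R : Semiring c ℓ) where

  open Semiring R using (Carrier; _≈_; _+_; _*_; +-congʳ) renaming (trans to ≈-trans; sym to ≈-sym)
  open import Algebra.Properties.Semiring.Sum R using (sum; sum-cong-≋; ∑-distrib-+; *-distribˡ-sum)

  sum-linear : ∀ {n} p (f g h : Vector Carrier n) → (∀ i → f i ≈ p * g i + h i) →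
               sum f ≈ p * sum g + sum h
  sum-linear p f g h f≈ = ≈-trans (sum-cong-≋ f≈)
    (≈-trans (∑-distrib-+ (λ i → p * g i) h) (+-congʳ (≈-sym (*-distribˡ-sum p g))))

-- Congruences of integers

open import Data.Integer using (_+_; _*_; -_; ∣_∣)

infix 4 _≡_mod_ _∣ₛ_

record _≡_mod_ (x y : ℤ) (m : ℕ) : Set where
  constructor mod-≡
  field ∣-difference : + m ∣ x - y

open _≡_mod_

_∣ₛ_ : ℤ → ℤ → Set
_∣ₛ_ = Signed._∣_

module _ {m : ℕ} where

  ∣ₛ⇒≡-mod : ∀ {x y} → + m ∣ₛ x - y → x ≡ y mod m
  ∣ₛ⇒≡-mod d = mod-≡ (Signed.∣⇒∣ᵤ d)

  ≡-mod⇒∣ₛ : ∀ {x y} → x ≡ y mod m → + m ∣ₛ x - y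
  ≡-mod⇒∣ₛ (mod-≡ d) = Signed.∣ᵤ⇒∣ d

  private
    ∣ₛ-via : ∀ {x y z} → z ≡ x - y → + m ∣ₛ z → x ≡ y mod m
    ∣ₛ-via eq d = ∣ₛ⇒≡-mod (subst (+ m ∣ₛ_) eq d)

    neg-sub : ∀ x y → - (x - y) ≡ y - x
    neg-sub = solve-∀

    sub-telescope : ∀ x y z → (x - y) + (y - z) ≡ x - z
    sub-telescope = solve-∀

    sub-+ : ∀ x x′ y y′ → (x - x′) + (y - y′) ≡ (x + y) - (x′ + y′)
    sub-+ = solve-∀

  ≡-mod-refl : ∀ {x} → x ≡ x mod m
  ≡-mod-refl {x} = ∣ₛ-via (sym (ℤ.+-inverseʳ x)) (Signed.divides (+ 0) refl)

  ≡-mod-sym : ∀ {x y} → x ≡ y mod m → y ≡ x mod m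
  ≡-mod-sym {x} {y} d = ∣ₛ-via (neg-sub x y) (Signed.∣m⇒∣-m (≡-mod⇒∣ₛ d))

  ≡-mod-trans : ∀ {x y z} → x ≡ y mod m → y ≡ z mod m → x ≡ z mod m
  ≡-mod-trans {x} {y} {z} d e =
    ∣ₛ-via (sub-telescope x y z) (Signed.∣m∣n⇒∣m+n (≡-mod⇒∣ₛ d) (≡-mod⇒∣ₛ e))

  +-cong-mod : ∀ {x x′ y y′} → x ≡ x′ mod m → y ≡ y′ mod m → x + y ≡ x′ + y′ mod m
  +-cong-mod {x} {x′} {y} {y′} d e =
    ∣ₛ-via (sub-+ x x′ y y′) (Signed.∣m∣n⇒∣m+n (≡-mod⇒∣ₛ d) (≡-mod⇒∣ₛ e))

  ∣⇒≡0-mod : ∀ {x} → + m ∣ x → x ≡ + 0 mod m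
  ∣⇒≡0-mod {x} d = mod-≡ (subst (+ m ∣_) (sym (ℤ.+-identityʳ x)) d)

  ≡0-mod⇒∣ : ∀ {x} → x ≡ + 0 mod m → + m ∣ x
  ≡0-mod⇒∣ {x} (mod-≡ d) = subst (+ m ∣_) (ℤ.+-identityʳ x) d

_≡?_mod_ : ∀ x y m → Dec (x ≡ y mod m)
x ≡? y mod m = Dec.map′ mod-≡ ∣-difference (m ℕ.∣? ∣ x - y ∣)

≡-mod-%ℕ : ∀ x m .{{_ : ℕ.NonZero m}} → x ≡ + (x %ℕ m) mod m
≡-mod-%ℕ x m = ∣ₛ⇒≡-mod (Signed.divides (x /ℕ m) (begin
  x - + (x %ℕ m)                           ≡⟨ cong (_- + (x %ℕ m)) (a≡a%ℕn+[a/ℕn]*n x m) ⟩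
  + (x %ℕ m) + (x /ℕ m) * + m - + (x %ℕ m) ≡⟨ cancel (+ (x %ℕ m)) ((x /ℕ m) * + m) ⟩
  (x /ℕ m) * + m                           ∎))
  where
  cancel : ∀ r s → r + s - r ≡ s
  cancel = solve-∀

mod3-cases : ∀ x → + 3 ∣ x ⊎ x ≡ + 1 mod 3 ⊎ x ≡ + 2 mod 3
mod3-cases x with x %ℕ 3 | ≡-mod-%ℕ x 3 | n%ℕd<d x 3
... | 0 | x≡0 | _ = inj₁ (≡0-mod⇒∣ x≡0)
... | 1 | x≡1 | _ = inj₂ (inj₁ x≡1)
... | 2 | x≡2 | _ = inj₂ (inj₂ x≡2)
... | suc (suc (suc _)) | _ | s<s (s<s (s<s ()))

three≡0 : + 3 ≡ + 0 mod 3
three≡0 = mod-≡ ℕ.∣-refl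

mod3-units-equal-or-opposite : ∀ x y → ¬ + 3 ∣ x → ¬ + 3 ∣ y → x ≡ y mod 3 ⊎ + 3 ∣ x + y
mod3-units-equal-or-opposite x y 3∤x 3∤y with mod3-cases x | mod3-cases y
... | inj₁ 3∣x | _ = ⊥-elim (3∤x 3∣x)
... | _ | inj₁ 3∣y = ⊥-elim (3∤y 3∣y)
... | inj₂ (inj₁ x≡1) | inj₂ (inj₁ y≡1) = inj₁ (≡-mod-trans x≡1 (≡-mod-sym y≡1))
... | inj₂ (inj₂ x≡2) | inj₂ (inj₂ y≡2) = inj₁ (≡-mod-trans x≡2 (≡-mod-sym y≡2))
... | inj₂ (inj₁ x≡1) | inj₂ (inj₂ y≡2) = inj₂ (≡0-mod⇒∣ (≡-mod-trans (+-cong-mod x≡1 y≡2) three≡0))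
... | inj₂ (inj₂ x≡2) | inj₂ (inj₁ y≡1) = inj₂ (≡0-mod⇒∣ (≡-mod-trans (+-cong-mod x≡2 y≡1) three≡0))

∣-third-of-zero-sum : ∀ {m} x y z → x + y + z ≡ + 0 → + m ∣ x + y → + m ∣ z
∣-third-of-zero-sum {m} x y z sum≡0 m∣x+y = Signed.∣⇒∣ᵤ {+ m} {z} (Signed.∣m+n∣m⇒∣n
  (subst (+ m ∣ₛ_) (sym sum≡0) (Signed.divides (+ 0) refl)) (Signed.∣ᵤ⇒∣ {+ m} {x + y} m∣x+y))

zero-sum-of-mod3-units : ∀ x y z → x + y + z ≡ + 0 → ¬ + 3 ∣ x → ¬ + 3 ∣ y → ¬ + 3 ∣ z →
                         x ≡ y mod 3 × y ≡ z mod 3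
zero-sum-of-mod3-units x y z sum≡0 3∤x 3∤y 3∤z =
  first-two x y z sum≡0 3∤x 3∤y 3∤z , first-two y z x (trans (rotate x y z) sum≡0) 3∤y 3∤z 3∤x
  where
  rotate : ∀ x y z → y + z + x ≡ x + y + z
  rotate = solve-∀
  first-two : ∀ x y z → x + y + z ≡ + 0 → ¬ + 3 ∣ x → ¬ + 3 ∣ y → ¬ + 3 ∣ z → x ≡ y mod 3
  first-two x y z sum≡0 3∤x 3∤y 3∤z with mod3-units-equal-or-opposite x y 3∤x 3∤y
  ... | inj₁ x≡y   = x≡y
  ... | inj₂ 3∣x+y = ⊥-elim (3∤z (∣-third-of-zero-sum x y z sum≡0 3∣x+y))

thrice-≡0-mod3 : ∀ r → r + r + r ≡ + 0 mod 3
thrice-≡0-mod3 r = ∣ₛ⇒≡-mod (Signed.divides r (thrice r))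
  where
  thrice : ∀ r → r + r + r - + 0 ≡ r * + 3
  thrice = solve-∀

K4-opposite-edges : ∀ {ij ik il jk jl kl} →
  + 3 ∣ₛ ij + ik + jk → + 3 ∣ₛ ij + il + jl → + 3 ∣ₛ ik + il + kl → + 3 ∣ₛ jk + jl + kl →
  ij ≡ kl mod 3 × ik ≡ jl mod 3 × il ≡ jk mod 3
K4-opposite-edges {ij} {ik} {il} {jk} {jl} {kl} ijk ijl ikl jkl =
    halve (identity₁ ij ik il jk jl kl) (sum-difference ijk ijl ikl jkl)
  , halve (identity₂ ij ik il jk jl kl) (sum-difference ijk ikl ijl jkl)
  , halve (identity₃ ij ik il jk jl kl) (sum-difference ijl ikl ijk jkl)
  where
  sum-difference : ∀ {a b c d} → + 3 ∣ₛ a → + 3 ∣ₛ b → + 3 ∣ₛ c → + 3 ∣ₛ d → + 3 ∣ₛ (a + b) - (c + d)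
  sum-difference a b c d = Signed.∣m∣n⇒∣m-n (Signed.∣m∣n⇒∣m+n a b) (Signed.∣m∣n⇒∣m+n c d)
  -- 2 is invertible mod 3: d = 2·(2d) − 3d.
  halve : ∀ {x y s} → s ≡ (x - y) * + 2 → + 3 ∣ₛ s → x ≡ y mod 3
  halve {x} {y} s≡ 3∣s = ∣ₛ⇒≡-mod (subst (+ 3 ∣ₛ_)
    (trans (cong (λ t → t * + 2 - (x - y) * + 3) s≡) (four-minus-three x y))
    (Signed.∣m∣n⇒∣m-n (Signed.∣m⇒∣m*n (+ 2) 3∣s) (Signed.∣n⇒∣m*n (x - y) Signed.∣-refl)))
    where
    four-minus-three : ∀ x y → (x - y) * + 2 * + 2 - (x - y) * + 3 ≡ x - y
    four-minus-three = solve-∀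
  identity₁ : ∀ ij ik il jk jl kl →
    (ij + ik + jk + (ij + il + jl)) - (ik + il + kl + (jk + jl + kl)) ≡ (ij - kl) * + 2
  identity₁ = solve-∀
  identity₂ : ∀ ij ik il jk jl kl →
    (ij + ik + jk + (ik + il + kl)) - (ij + il + jl + (jk + jl + kl)) ≡ (ik - jl) * + 2
  identity₂ = solve-∀
  identity₃ : ∀ ij ik il jk jl kl →
    (ij + il + jl + (ik + il + kl)) - (ij + ik + jk + (jk + jl + kl)) ≡ (il - jk) * + 2
  identity₃ = solve-∀

-- Pairing edge functions with edge vectors

ℚ-semiring : Semiring 0ℓ 0ℓ
ℚ-semiring = CommutativeRing.semiring ℚ.+-*-commutativeRing

open import Algebra.Properties.Semiring.Sum ℚ-semiring using (sum-syntax)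

module _ {n : ℕ} where

  extendByZero : (Edge n → ℚ) → Fin n → Fin n → ℚ
  extendByZero f i j with i <? j
  ... | yes i<j = f ((i , j) , i<j)
  ... | no  _   = 0ℚ

  ∑-edges : (Edge n → ℚ) → ℚ
  ∑-edges f = ∑[ i < n ] ∑[ j < n ] extendByZero f i j

  VanishesOff : (Edge n → ℚ) → Edge n → Set
  VanishesOff f e = ∀ e′ → ¬ proj₁ e′ ≡ proj₁ e → f e′ ≡ 0ℚ

  ∑-edges-linear : ∀ p (f g h : Edge n → ℚ) → (∀ e → f e ≡ p ℚ.* g e ℚ.+ h e) →
                   ∑-edges f ≡ p ℚ.* ∑-edges g ℚ.+ ∑-edges h
  ∑-edges-linear p f g h f≡ =
    sum-linear ℚ-semiring p _ _ _ λ i → sum-linear ℚ-semiring p _ _ _ λ j → extendByZero-linear i j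
    where
    extendByZero-linear : ∀ i j → extendByZero f i j ≡ p ℚ.* extendByZero g i j ℚ.+ extendByZero h i j
    extendByZero-linear i j with i <? j
    ... | yes _ = f≡ _
    ... | no  _ = sym (trans (cong (ℚ._+ 0ℚ) (ℚ.*-zeroʳ p)) (ℚ.+-identityʳ 0ℚ))

  ∑-edges-zero : ∀ f → (∀ e → f e ≡ 0ℚ) → ∑-edges f ≡ 0ℚ
  ∑-edges-zero f f≡0 = sum-zero ℚ.+-0-monoid _ λ i → sum-zero ℚ.+-0-monoid _ λ j → extendByZero-zero i j
    where
    extendByZero-zero : ∀ i j → extendByZero f i j ≡ 0ℚ
    extendByZero-zero i j with i <? j
    ... | yes _ = f≡0 _
    ... | no  _ = refl

  ∑-edges-single : ∀ f e → VanishesOff f e → ∑-edges f ≡ f e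
  ∑-edges-single f e@((u , v) , u<v) off = begin
    ∑[ i < n ] ∑[ j < n ] extendByZero f i j
      ≡⟨ sum-single ℚ.+-0-monoid _ u (λ i i≢u →
           sum-zero ℚ.+-0-monoid _ λ j → extendByZero-off i j (i≢u ∘ cong proj₁)) ⟩
    ∑[ j < n ] extendByZero f u j
      ≡⟨ sum-single ℚ.+-0-monoid _ v (λ j j≢v → extendByZero-off u j (j≢v ∘ cong proj₂)) ⟩
    extendByZero f u v
      ≡⟨ extendByZero-at ⟩
    f e ∎
    where
    extendByZero-off : ∀ i j → ¬ (i , j) ≡ (u , v) → extendByZero f i j ≡ 0ℚ
    extendByZero-off i j ij≢uv with i <? j
    ... | yes _ = off _ ij≢uv
    ... | no  _ = refl
    extendByZero-at : extendByZero f u v ≡ f e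
    extendByZero-at with u <? v
    ... | yes u<v′ = cong (λ p → f ((u , v) , p)) (<-irrelevant u<v′ u<v)
    ... | no  u≮v  = ⊥-elim (u≮v u<v)

  ⟪_,_⟫ : (Edge n → ℚ) → ℚVec n → ℚ
  ⟪ a , v ⟫ = ∑-edges (λ e → a e ℚ.* v e)

  ⟪⟫-linear : ∀ a p (u v w : ℚVec n) → (∀ e → u e ≡ p ℚ.* v e ℚ.+ w e) →
              ⟪ a , u ⟫ ≡ p ℚ.* ⟪ a , v ⟫ ℚ.+ ⟪ a , w ⟫
  ⟪⟫-linear a p u v w u≡ = ∑-edges-linear p _ _ _ λ e →
    trans (cong (a e ℚ.*_) (u≡ e)) (distrib (a e) p (v e) (w e))
    where
    open +-*-Solver
    distrib : ∀ a p v w → a ℚ.* (p ℚ.* v ℚ.+ w) ≡ p ℚ.* (a ℚ.* v) ℚ.+ a ℚ.* w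
    distrib = solve 4 (λ a p v w → a :* (p :* v :+ w) := p :* (a :* v) :+ a :* w) refl

  ⟪⟫-additive : ∀ a (u v w : ℚVec n) → (∀ e → u e ≡ v e ℚ.+ w e) →
                ⟪ a , u ⟫ ≡ ⟪ a , v ⟫ ℚ.+ ⟪ a , w ⟫
  ⟪⟫-additive a u v w u≡ =
    trans (⟪⟫-linear a 1ℚ u v w λ e → trans (u≡ e) (cong (ℚ._+ w e) (sym (ℚ.*-identityˡ (v e)))))
          (cong (ℚ._+ ⟪ a , w ⟫) (ℚ.*-identityˡ ⟪ a , v ⟫))

  ⟪⟫-zero : ∀ a (v : ℚVec n) → (∀ e → v e ≡ 0ℚ) → ⟪ a , v ⟫ ≡ 0ℚ
  ⟪⟫-zero a v v≡0 = ∑-edges-zero _ λ e → trans (cong (a e ℚ.*_) (v≡0 e)) (ℚ.*-zeroʳ (a e))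

  δ : Edge n → ℚVec n
  δ ((i , j) , _) ((a , b) , _) with (a ≟ i) ×-dec (b ≟ j)
  ... | yes _ = 1ℚ
  ... | no  _ = 0ℚ

  δ-self : ∀ e → δ e e ≡ 1ℚ
  δ-self ((i , j) , _) with (i ≟ i) ×-dec (j ≟ j)
  ... | yes _ = refl
  ... | no  ≢ = ⊥-elim (≢ (refl , refl))

  δ-off : ∀ e e′ → ¬ proj₁ e′ ≡ proj₁ e → δ e e′ ≡ 0ℚ
  δ-off ((i , j) , _) ((a , b) , _) ≢ with (a ≟ i) ×-dec (b ≟ j)
  ... | yes (refl , refl) = ⊥-elim (≢ refl)
  ... | no  _             = refl

  ⟪⟫-δ : ∀ a e → ⟪ a , δ e ⟫ ≡ a e
  ⟪⟫-δ a e = begin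
    ⟪ a , δ e ⟫
      ≡⟨ ∑-edges-single _ e (λ e′ ≢ → trans (cong (a e′ ℚ.*_) (δ-off e e′ ≢)) (ℚ.*-zeroʳ (a e′))) ⟩
    a e ℚ.* δ e e  ≡⟨ cong (a e ℚ.*_) (δ-self e) ⟩
    a e ℚ.* 1ℚ     ≡⟨ ℚ.*-identityʳ (a e) ⟩
    a e            ∎

  𝟙-decomposition : ∀ K e → 𝟙 K e ≡ δ (e₁ K) e ℚ.+ δ (e₂ K) e ℚ.+ δ (e₃ K) e
  𝟙-decomposition ((i , j , k) , i<j , j<k) ((a , b) , _)
    with (a ≟ i) ×-dec (b ≟ j) | (a ≟ i) ×-dec (b ≟ k) | (a ≟ j) ×-dec (b ≟ k)
  ... | yes (_ , refl) | yes (_ , refl) | _              = ⊥-elim (<-irrefl refl j<k)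
  ... | yes (refl , _) | _              | yes (refl , _) = ⊥-elim (<-irrefl refl i<j)
  ... | _              | yes (refl , _) | yes (refl , _) = ⊥-elim (<-irrefl refl i<j)
  ... | yes _ | no _  | no _  = refl
  ... | no _  | yes _ | no _  = refl
  ... | no _  | no _  | yes _ = refl
  ... | no _  | no _  | no _  = refl

  ⟪⟫-𝟙 : ∀ a K → ⟪ a , 𝟙 K ⟫ ≡ a (e₁ K) ℚ.+ a (e₂ K) ℚ.+ a (e₃ K)
  ⟪⟫-𝟙 a K = begin
    ⟪ a , 𝟙 K ⟫
      ≡⟨ ⟪⟫-additive a _ _ (δ (e₃ K)) (𝟙-decomposition K) ⟩
    ⟪ a , (λ e → δ (e₁ K) e ℚ.+ δ (e₂ K) e) ⟫ ℚ.+ ⟪ a , δ (e₃ K) ⟫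
      ≡⟨ cong (ℚ._+ ⟪ a , δ (e₃ K) ⟫) (⟪⟫-additive a _ (δ (e₁ K)) (δ (e₂ K)) λ _ → refl) ⟩
    ⟪ a , δ (e₁ K) ⟫ ℚ.+ ⟪ a , δ (e₂ K) ⟫ ℚ.+ ⟪ a , δ (e₃ K) ⟫
      ≡⟨ cong₂ ℚ._+_ (cong₂ ℚ._+_ (⟪⟫-δ a (e₁ K)) (⟪⟫-δ a (e₂ K))) (⟪⟫-δ a (e₃ K)) ⟩
    a (e₁ K) ℚ.+ a (e₂ K) ℚ.+ a (e₃ K) ∎

  AnnihilatesTight : ℤVec n → (Edge n → ℚ) → Set
  AnnihilatesTight y a = ∀ K → Tight y K → a (e₁ K) ℚ.+ a (e₂ K) ℚ.+ a (e₃ K) ≡ 0ℚ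

  ⟪⟫-vanishes-on-tightSpan : ∀ y a {v} → AnnihilatesTight y a → InTightSpan y v → ⟪ a , v ⟫ ≡ 0ℚ
  ⟪⟫-vanishes-on-tightSpan y a annihilates (L , tight , v≡) = combination L tight _ v≡
    where
    combination : ∀ L → All (Tight y ∘ proj₁) L → ∀ v →
      (∀ e → v e ≡ foldr ℚ._+_ 0ℚ (map (λ (K , c) → c ℚ.* 𝟙 K e) L)) → ⟪ a , v ⟫ ≡ 0ℚ
    combination [] [] v v≡ = ⟪⟫-zero a v v≡
    combination ((K , c) ∷ L) (K-tight ∷ tight) v v≡ = begin
      ⟪ a , v ⟫                              ≡⟨ ⟪⟫-linear a c v (𝟙 K) rest v≡ ⟩
      c ℚ.* ⟪ a , 𝟙 K ⟫ ℚ.+ ⟪ a , rest ⟫     ≡⟨ cong₂ (λ s t → c ℚ.* s ℚ.+ t)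
                                                   (trans (⟪⟫-𝟙 a K) (annihilates K K-tight))
                                                   (combination L tight rest λ _ → refl) ⟩
      c ℚ.* 0ℚ ℚ.+ 0ℚ                        ≡⟨ trans (ℚ.+-identityʳ _) (ℚ.*-zeroʳ c) ⟩
      0ℚ                                     ∎
      where
      rest : ℚVec n
      rest e = foldr ℚ._+_ 0ℚ (map (λ (K , c) → c ℚ.* 𝟙 K e) L)

  tightSpan-codim1⇒annihilators-proportional : ∀ y a b → TightSpanCodim1 y →
    AnnihilatesTight y a → AnnihilatesTight y b →
    ∀ u v → ⟪ a , u ⟫ ℚ.* ⟪ b , v ⟫ ≡ ⟪ a , v ⟫ ℚ.* ⟪ b , u ⟫
  tightSpan-codim1⇒annihilators-proportional y a b (w , _ , split) a-ann b-ann u v = begin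
    ⟪ a , u ⟫ ℚ.* ⟪ b , v ⟫                      ≡⟨ cong₂ ℚ._*_ (along-w a a-ann u) (along-w b b-ann v) ⟩
    (c u ℚ.* ⟪ a , w ⟫) ℚ.* (c v ℚ.* ⟪ b , w ⟫)  ≡⟨ swap (c u) (c v) ⟪ a , w ⟫ ⟪ b , w ⟫ ⟩
    (c v ℚ.* ⟪ a , w ⟫) ℚ.* (c u ℚ.* ⟪ b , w ⟫)  ≡⟨ cong₂ ℚ._*_ (along-w a a-ann v) (along-w b b-ann u) ⟨
    ⟪ a , v ⟫ ℚ.* ⟪ b , u ⟫                      ∎
    where
    open +-*-Solver
    c : ℚVec n → ℚ
    c u = proj₁ (split u)
    swap : ∀ p q A B → (p ℚ.* A) ℚ.* (q ℚ.* B) ≡ (q ℚ.* A) ℚ.* (p ℚ.* B)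
    swap = solve 4 (λ p q A B → (p :* A) :* (q :* B) := (q :* A) :* (p :* B)) refl
    decompose : ∀ p x y → x ≡ p ℚ.* y ℚ.+ (x ℚ.- p ℚ.* y)
    decompose = solve 3 (λ p x y → x := p :* y :+ (x :- p :* y)) refl
    along-w : ∀ a → AnnihilatesTight y a → ∀ u → ⟪ a , u ⟫ ≡ c u ℚ.* ⟪ a , w ⟫
    along-w a a-ann u = begin
      ⟪ a , u ⟫
        ≡⟨ ⟪⟫-linear a (c u) u w _ (λ e → decompose (c u) (u e) (w e)) ⟩
      c u ℚ.* ⟪ a , w ⟫ ℚ.+ ⟪ a , (λ e → u e ℚ.- c u ℚ.* w e) ⟫
        ≡⟨ cong (c u ℚ.* ⟪ a , w ⟫ ℚ.+_) (⟪⟫-vanishes-on-tightSpan y a a-ann (proj₂ (split u))) ⟩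
      c u ℚ.* ⟪ a , w ⟫ ℚ.+ 0ℚ
        ≡⟨ ℚ.+-identityʳ _ ⟩
      c u ℚ.* ⟪ a , w ⟫ ∎

  annihilators-proportional-on-edges : ∀ y a b → TightSpanCodim1 y →
    AnnihilatesTight y a → AnnihilatesTight y b → ∀ e e′ → a e ℚ.* b e′ ≡ a e′ ℚ.* b e
  annihilators-proportional-on-edges y a b codim1 a-ann b-ann e e′ = begin
    a e ℚ.* b e′                    ≡⟨ cong₂ ℚ._*_ (⟪⟫-δ a e) (⟪⟫-δ b e′) ⟨
    ⟪ a , δ e ⟫ ℚ.* ⟪ b , δ e′ ⟫   ≡⟨ tightSpan-codim1⇒annihilators-proportional y a b codim1 a-ann b-ann _ _ ⟩
    ⟪ a , δ e′ ⟫ ℚ.* ⟪ b , δ e ⟫   ≡⟨ cong₂ ℚ._*_ (⟪⟫-δ a e′) (⟪⟫-δ b e) ⟩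
    a e′ ℚ.* b e                    ∎

-- Facet normals without entries divisible by 3

fromℤ-homo-+ : ∀ i j → fromℤ (i + j) ≡ fromℤ i ℚ.+ fromℤ j
fromℤ-homo-+ i j = ℚ.toℚᵘ-injective
  (ℚᵘ.≃-trans (ℚᵘ.*≡* (eq i j)) (ℚᵘ.≃-sym (ℚ.toℚᵘ-homo-+ (fromℤ i) (fromℤ j))))
  where
  eq : ∀ i j → (i + j) * + 1 ≡ (i * + 1 + j * + 1) * + 1
  eq = solve-∀

fromℤ-homo-* : ∀ i j → fromℤ (i * j) ≡ fromℤ i ℚ.* fromℤ j
fromℤ-homo-* i j = ℚ.toℚᵘ-injective
  (ℚᵘ.≃-trans (ℚᵘ.*≡* refl) (ℚᵘ.≃-sym (ℚ.toℚᵘ-homo-* (fromℤ i) (fromℤ j))))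

fromℤ-no-zero-divisors : ∀ i j → fromℤ i ℚ.* fromℤ j ≡ 0ℚ → i ≡ + 0 ⊎ j ≡ + 0
fromℤ-no-zero-divisors i j eq = ℤ.i*j≡0⇒i≡0∨j≡0 i (cong ℚ.↥_ (trans (fromℤ-homo-* i j) eq))

module _ {n : ℕ} (y : ℤVec n) where

  fromℤ-annihilatesTight : AnnihilatesTight y (fromℤ ∘ y)
  fromℤ-annihilatesTight K tight = begin
    fromℤ (y (e₁ K)) ℚ.+ fromℤ (y (e₂ K)) ℚ.+ fromℤ (y (e₃ K))
      ≡⟨ cong (ℚ._+ fromℤ (y (e₃ K))) (fromℤ-homo-+ (y (e₁ K)) (y (e₂ K))) ⟨
    fromℤ (y (e₁ K) + y (e₂ K)) ℚ.+ fromℤ (y (e₃ K))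
      ≡⟨ fromℤ-homo-+ (y (e₁ K) + y (e₂ K)) (y (e₃ K)) ⟨
    fromℤ ⟨ y ,𝟙 K ⟩
      ≡⟨ cong fromℤ tight ⟩
    0ℚ ∎

  restrict : (Edge n → Bool) → (Edge n → ℚ) → Edge n → ℚ
  restrict c a e = if c e then a e else 0ℚ

  ConstantOnTight : (Edge n → Bool) → Set
  ConstantOnTight c = ∀ K → Tight y K → c (e₁ K) ≡ c (e₂ K) × c (e₂ K) ≡ c (e₃ K)

  restrict-annihilatesTight : ∀ c a → ConstantOnTight c → AnnihilatesTight y a →
                              AnnihilatesTight y (restrict c a)
  restrict-annihilatesTight c a constant a-ann K tight
    with c (e₁ K) | c (e₂ K) | c (e₃ K) | constant K tight
  ... | true  | true  | true  | _      = a-ann K tight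
  ... | false | false | false | _      = refl
  ... | true  | false | _     | () , _
  ... | false | true  | _     | () , _
  ... | true  | true  | false | _ , ()
  ... | false | false | true  | _ , ()

  residueClass-constantOnTight : (∀ e → ¬ + 3 ∣ y e) → ∀ r → ConstantOnTight (λ e → does (y e ≡? r mod 3))
  residueClass-constantOnTight 3∤y r K tight = same-class (proj₁ congruent) , same-class (proj₂ congruent)
    where
    congruent : y (e₁ K) ≡ y (e₂ K) mod 3 × y (e₂ K) ≡ y (e₃ K) mod 3
    congruent = zero-sum-of-mod3-units (y (e₁ K)) (y (e₂ K)) (y (e₃ K)) tight
                                       (3∤y (e₁ K)) (3∤y (e₂ K)) (3∤y (e₃ K))
    same-class : ∀ {x x′} → x ≡ x′ mod 3 → does (x ≡? r mod 3) ≡ does (x′ ≡? r mod 3)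
    same-class {x} {x′} x≡x′ = does-⇔
      (mk⇔ (≡-mod-trans (≡-mod-sym x≡x′)) (≡-mod-trans x≡x′)) (x ≡? r mod 3) (x′ ≡? r mod 3)

  3∤entries⇒congruent-entries : TightSpanCodim1 y → (∀ e → ¬ + 3 ∣ y e) →
                                 ∀ e₀ e → y e ≡ y e₀ mod 3
  3∤entries⇒congruent-entries codim1 3∤y e₀ e with y e ≡? y e₀ mod 3 in e-class
  ... | yes e≡e₀ = e≡e₀
  ... | no  _    =
    ⊥-elim ([ 3∤y e₀ ∘ 3∣zero , 3∤y e ∘ 3∣zero ]′ (fromℤ-no-zero-divisors (y e₀) (y e) product≡0))
    where
    inClass : Edge n → Bool
    inClass e = does (y e ≡? y e₀ mod 3)
    inClass-constant : ConstantOnTight inClass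
    inClass-constant = residueClass-constantOnTight 3∤y (y e₀)
    outClass-constant : ConstantOnTight (not ∘ inClass)
    outClass-constant K tight = let (c₁₂ , c₂₃) = inClass-constant K tight in cong not c₁₂ , cong not c₂₃
    a₁ a₂ : Edge n → ℚ
    a₁ = restrict inClass (fromℤ ∘ y)
    a₂ = restrict (not ∘ inClass) (fromℤ ∘ y)
    3∣zero : ∀ {x} → x ≡ + 0 → + 3 ∣ x
    3∣zero refl = 3 ℕ.∣0
    e₀-in : inClass e₀ ≡ true
    e₀-in = dec-true (y e₀ ≡? y e₀ mod 3) ≡-mod-refl
    e-out : inClass e ≡ false
    e-out = cong does e-class
    product≡0 : fromℤ (y e₀) ℚ.* fromℤ (y e) ≡ 0ℚ
    product≡0 = begin
      fromℤ (y e₀) ℚ.* fromℤ (y e)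
        ≡⟨ cong₂ ℚ._*_ (cong (if_then fromℤ (y e₀) else 0ℚ) e₀-in)
                       (cong (λ b → if not b then fromℤ (y e) else 0ℚ) e-out) ⟨
      a₁ e₀ ℚ.* a₂ e
        ≡⟨ annihilators-proportional-on-edges y a₁ a₂ codim1
             (restrict-annihilatesTight inClass (fromℤ ∘ y) inClass-constant fromℤ-annihilatesTight)
             (restrict-annihilatesTight (not ∘ inClass) (fromℤ ∘ y) outClass-constant fromℤ-annihilatesTight)
             e₀ e ⟩
      a₁ e ℚ.* a₂ e₀
        ≡⟨ cong₂ ℚ._*_ (cong (if_then fromℤ (y e) else 0ℚ) e-out)
                       (cong (λ b → if not b then fromℤ (y e₀) else 0ℚ) e₀-in) ⟩
      0ℚ ℚ.* 0ℚ
        ≡⟨⟩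
      0ℚ ∎

-- Vectors whose triangle sums are divisible by 3

module _ {n : ℕ} (y : ℤVec n) where

  -- Recomputing the proof makes entry i j p definitionally independent of p.
  entry : (i j : Fin n) → .(i < j) → ℤ
  entry i j i<j = y ((i , j) , recompute (i <? j) i<j)

  entry-edge : ∀ {i j} (i<j : i < j) → y ((i , j) , i<j) ≡ entry i j i<j
  entry-edge {i} {j} i<j = cong (λ p → y ((i , j) , p)) (<-irrelevant _ _)

  triangle-entries : ∀ {i j k} (i<j : i < j) (j<k : j < k) →
    ⟨ y ,𝟙 ((i , j , k) , i<j , j<k) ⟩ ≡ entry i j i<j + entry i k (<-trans i<j j<k) + entry j k j<k
  triangle-entries i<j j<k =
    cong₂ _+_ (cong₂ _+_ (entry-edge i<j) (entry-edge (<-trans i<j j<k))) (entry-edge j<k)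

  opposite-entries : (∀ K → + 3 ∣ ⟨ y ,𝟙 K ⟩) →
    ∀ i j k l (i<j : i < j) (j<k : j < k) (k<l : k < l) →
      entry i j i<j ≡ entry k l k<l mod 3 ×
      entry i k (<-trans i<j j<k) ≡ entry j l (<-trans j<k k<l) mod 3 ×
      entry i l (<-trans i<j (<-trans j<k k<l)) ≡ entry j k j<k mod 3
  opposite-entries 3∣triangles i j k l i<j j<k k<l = K4-opposite-edges
    (triangle i<j j<k) (triangle i<j (<-trans j<k k<l)) (triangle (<-trans i<j j<k) k<l) (triangle j<k k<l)
    where
    triangle : ∀ {i j k} (i<j : i < j) (j<k : j < k) →
      + 3 ∣ₛ entry i j i<j + entry i k (<-trans i<j j<k) + entry j k j<k
    triangle {i} {j} {k} i<j j<k = subst (+ 3 ∣ₛ_) (triangle-entries i<j j<k)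
      (Signed.∣ᵤ⇒∣ {+ 3} {⟨ y ,𝟙 ((i , j , k) , i<j , j<k) ⟩} (3∣triangles _))

module _ {m : ℕ} where

  private
    v₀ v₁ v₂ v₃ v₄ : Fin (5 ℕ.+ m)
    v₀ = zero
    v₁ = suc zero
    v₂ = suc (suc zero)
    v₃ = suc (suc (suc zero))
    v₄ = suc (suc (suc (suc zero)))

    v₀<v₁ : v₀ < v₁
    v₀<v₁ = z<s
    v₁<v₂ : v₁ < v₂
    v₁<v₂ = s<s z<s
    v₁<v₃ : v₁ < v₃
    v₁<v₃ = s<s z<s
    v₂<v₃ : v₂ < v₃
    v₂<v₃ = s<s (s<s z<s)
    v₂<v₄ : v₂ < v₄
    v₂<v₄ = s<s (s<s z<s)
    v₃<v₄ : v₃ < v₄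
    v₃<v₄ = s<s (s<s (s<s z<s))

  edge₀₁ : Edge (5 ℕ.+ m)
  edge₀₁ = (v₀ , v₁) , v₀<v₁

  3∣triangles⇒congruent-entries : (y : ℤVec (5 ℕ.+ m)) → (∀ K → + 3 ∣ ⟨ y ,𝟙 K ⟩) →
                                  ∀ e → y e ≡ y edge₀₁ mod 3
  3∣triangles⇒congruent-entries y 3∣triangles ((i , j) , i<j) =
    subst₂ (λ a b → a ≡ b mod 3) (sym (entry-edge y i<j)) (sym (entry-edge y v₀<v₁)) (from i j i<j)
    where
    -- An edge s j with s ∈ {v₀, v₁} is opposite to an edge inside {v₂, v₃, v₄} ∖ {j}, which in
    -- turn is opposite to v₀v₁; this is where n ≥ 5 is used.
    avoiding-v₀v₁ : ∀ k l (v₁<k : v₁ < k) (k<l : k < l) → entry y k l k<l ≡ entry y v₀ v₁ v₀<v₁ mod 3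
    avoiding-v₀v₁ k l v₁<k k<l =
      ≡-mod-sym (proj₁ (opposite-entries y 3∣triangles v₀ v₁ k l v₀<v₁ v₁<k k<l))
    touching-v₀v₁ : ∀ s j (s<v₂ : s < v₂) (s<j : s < j) → v₁ < j →
                    entry y s j s<j ≡ entry y v₀ v₁ v₀<v₁ mod 3
    touching-v₀v₁ s (suc zero) _ _ (s≤s ())
    touching-v₀v₁ s (suc (suc zero)) s<v₂ _ _ = ≡-mod-trans
      (proj₁ (opposite-entries y 3∣triangles s v₂ v₃ v₄ s<v₂ v₂<v₃ v₃<v₄))
      (avoiding-v₀v₁ v₃ v₄ v₁<v₃ v₃<v₄)
    touching-v₀v₁ s (suc (suc (suc zero))) s<v₂ _ _ = ≡-mod-trans
      (proj₁ (proj₂ (opposite-entries y 3∣triangles s v₂ v₃ v₄ s<v₂ v₂<v₃ v₃<v₄)))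
      (avoiding-v₀v₁ v₂ v₄ v₁<v₂ v₂<v₄)
    touching-v₀v₁ s j@(suc (suc (suc (suc _)))) s<v₂ _ _ = ≡-mod-trans
      (proj₂ (proj₂ (opposite-entries y 3∣triangles s v₂ v₃ j s<v₂ v₂<v₃ (s<s (s<s (s<s z<s))))))
      (avoiding-v₀v₁ v₂ v₃ v₁<v₂ v₂<v₃)
    from : ∀ i j (i<j : i < j) → entry y i j i<j ≡ entry y v₀ v₁ v₀<v₁ mod 3
    from zero          (suc zero)    _   = ≡-mod-refl
    from zero          (suc (suc j)) i<j = touching-v₀v₁ v₀ (suc (suc j)) z<s i<j (s<s z<s)
    from (suc zero)    (suc zero)    (s≤s ())
    from (suc zero)    (suc (suc j)) i<j = touching-v₀v₁ v₁ (suc (suc j)) v₁<v₂ i<j (s<s z<s)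
    from (suc (suc i)) j             i<j = avoiding-v₀v₁ (suc (suc i)) j (s<s z<s) i<j

-- Vectors with all entries ≡ 1 or all entries ≡ 2 mod 3

module _ {n : ℕ} (y : ℤVec n) where

  UniformUnitResidue : Set
  UniformUnitResidue = (∀ e → + 3 ∣ (y e - + 1)) ⊎ (∀ e → + 3 ∣ (y e - + 2))

  congruent-entries⇒uniformUnitResidue : ∀ e₀ → (∀ e → y e ≡ y e₀ mod 3) →
    ¬ (∀ e → + 3 ∣ y e) → UniformUnitResidue
  congruent-entries⇒uniformUnitResidue e₀ congruent not-all-divisible with mod3-cases (y e₀)
  ... | inj₁ 3∣y₀ =
    ⊥-elim (not-all-divisible λ e → ≡0-mod⇒∣ (≡-mod-trans (congruent e) (∣⇒≡0-mod 3∣y₀)))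
  ... | inj₂ (inj₁ y₀≡1) = inj₁ λ e → ∣-difference (≡-mod-trans (congruent e) y₀≡1)
  ... | inj₂ (inj₂ y₀≡2) = inj₂ λ e → ∣-difference (≡-mod-trans (congruent e) y₀≡2)

  congruent-entries⇒3∣triangles : ∀ r → (∀ e → y e ≡ r mod 3) → ∀ K → + 3 ∣ ⟨ y ,𝟙 K ⟩
  congruent-entries⇒3∣triangles r ≡r K =
    ≡0-mod⇒∣ (≡-mod-trans (+-cong-mod (+-cong-mod (≡r (e₁ K)) (≡r (e₂ K))) (≡r (e₃ K))) (thrice-≡0-mod3 r))

  congruent-entries⇒3∤entries : ∀ r → ¬ + 3 ∣ r → (∀ e → y e ≡ r mod 3) → ∀ e → ¬ + 3 ∣ y e
  congruent-entries⇒3∤entries r 3∤r ≡r e 3∣y =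
    3∤r (≡0-mod⇒∣ (≡-mod-trans (≡-mod-sym (≡r e)) (∣⇒≡0-mod 3∣y)))

  uniformUnitResidue⇒3∣triangles : UniformUnitResidue → ∀ K → + 3 ∣ ⟨ y ,𝟙 K ⟩
  uniformUnitResidue⇒3∣triangles (inj₁ ≡1) = congruent-entries⇒3∣triangles (+ 1) (mod-≡ ∘ ≡1)
  uniformUnitResidue⇒3∣triangles (inj₂ ≡2) = congruent-entries⇒3∣triangles (+ 2) (mod-≡ ∘ ≡2)

  uniformUnitResidue⇒3∤entries : UniformUnitResidue → ∀ e → ¬ + 3 ∣ y e
  uniformUnitResidue⇒3∤entries (inj₁ ≡1) = congruent-entries⇒3∤entries (+ 1) (from-no (3 ℕ.∣? 1)) (mod-≡ ∘ ≡1)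
  uniformUnitResidue⇒3∤entries (inj₂ ≡2) = congruent-entries⇒3∤entries (+ 2) (from-no (3 ℕ.∣? 2)) (mod-≡ ∘ ≡2)

standardForm⇒¬3∣all-entries : ∀ {n} (y : ℤVec n) → StandardForm y → ¬ (∀ e → + 3 ∣ y e)
standardForm⇒¬3∣all-entries y standard all-divisible with standard (+ 3) all-divisible
... | ()

proposition3p3 : (n : ℕ) → 5 ≤ n → (y : ℤVec n) → FacetNormal y → StandardForm y →
    ((∀ (K : Triangle n) → + 3 ∣ ⟨ y ,𝟙 K ⟩) ⇔ (∀ (e : Edge n) → ¬ (+ 3 ∣ y e)))
    × ((∀ (e : Edge n) → ¬ (+ 3 ∣ y e))
       ⇔ ((∀ (e : Edge n) → + 3 ∣ (y e - + 1)) ⊎ (∀ (e : Edge n) → + 3 ∣ (y e - + 2))))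
proposition3p3 (suc (suc (suc (suc (suc m))))) (s≤s (s≤s (s≤s (s≤s (s≤s z≤n))))) y (_ , codim1) standard =
    mk⇔ (uniformUnitResidue⇒3∤entries y ∘ a⇒c) (uniformUnitResidue⇒3∣triangles y ∘ b⇒c)
  , mk⇔ b⇒c (uniformUnitResidue⇒3∤entries y)
  where
  a⇒c : (∀ K → + 3 ∣ ⟨ y ,𝟙 K ⟩) → UniformUnitResidue y
  a⇒c 3∣triangles = congruent-entries⇒uniformUnitResidue y edge₀₁
    (3∣triangles⇒congruent-entries y 3∣triangles) (standardForm⇒¬3∣all-entries y standard)
  b⇒c : (∀ e → ¬ + 3 ∣ y e) → UniformUnitResidue y
  b⇒c 3∤y = congruent-entries⇒uniformUnitResidue y edge₀₁
    (3∤entries⇒congruent-entries y codim1 3∤y edge₀₁) (λ all → 3∤y edge₀₁ (all edge₀₁))
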